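{- Let $m,n$ be positive integers. The Cartesian product $K_m\times K_n$ of the complete graphs $K_m$ and $K_n$ is a circulant graph if and only if either $\gcd(m,n)=1$ or $m=n=2$.
   Context: $K_m$ denotes the complete graph (no loops) on $m$ vertices. The Cartesian product $G\times H$ has vertex set $V(G)\times V(H)$, with $(g,h)$ adjacent to $(g',h')$ iff either $g=g'$ and $h$ is adjacent to $h'$, or $h=h'$ and $g$ is adjacent to $g'$. A graph on $N$ vertices is circulant if its vertices can be labeled by $\mathbb{Z}_N$ so that, for some set $S\subseteq\mathbb{Z}_N$ with $S=-S$, vertices $i$ and $j$ are adjacent iff $j-i\in S\pmod N$. -}

module Defs where

open import Level using (0ℓ)
open import Data.Nat using (ℕ; zero; suc; _+_; _∸_)
open import Data.Nat.DivMod using (_mod_)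
open import Data.Fin using (Fin; toℕ)
open import Data.Product using (_×_; Σ; ∃)
open import Data.Sum using (_⊎_)
open import Function.Bundles using (_⤖_; Bijection)
open import Relation.Binary.PropositionalEquality using (_≡_; _≢_)
open import Relation.Nullary using (¬_)

record Graph : Set₁ where
  field
    V   : Set
    Adj : V → V → Set
open Graph public

K : ℕ → Graph
K m = record { V = Fin m ; Adj = λ i j → i ≢ j }

_□_ : Graph → Graph → Graph
G □ H = record
  { V = V G × V H
  ; Adj = λ { (g , h) (g′ , h′) →
        (g ≡ g′ × Adj H h h′) ⊎ (h ≡ h′ × Adj G g g′) } }
  where open import Data.Product using (_,_)

negMod : ∀ {N} → Fin N → Fin N
negMod {suc k} i = ((suc k) ∸ toℕ i) mod (suc k)

subMod : ∀ {N} → Fin N → Fin N → Fin N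
subMod {suc k} j i = (toℕ j + ((suc k) ∸ toℕ i)) mod (suc k)

IsCirculant : Graph → Set₁
IsCirculant G =
  Σ ℕ λ N →
  Σ (Fin N ⤖ V G) λ lab →
  Σ (Fin N → Set) λ S →
    (∀ s → S s → S (negMod s)) ×
    (∀ i j → (Adj G (Bijection.to lab i) (Bijection.to lab j) → S (subMod j i))
           × (S (subMod j i) → Adj G (Bijection.to lab i) (Bijection.to lab j)))

module Submission where

-- A labelling of the vertices of a graph by ℤ/N is translation invariant when i ~ j ⇔ 0 ~ j − i;
-- for a symmetric graph this is exactly circulance, with S the neighbourhood of 0. If gcd m n = 1,
-- the Chinese remainder labelling i ↦ (i mod m, i mod n) of K_m □ K_n is translation invariant, and
-- K₂ □ K₂ is the 4-cycle. Conversely, fix a translation invariant labelling with m ≥ 3 or n ≥ 3.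
-- Two distinct common neighbours of an edge of K_m □ K_n lie on the line of that edge; applied to the
-- square 0, p, q, p + q, this shows that the row R of 0 is closed under negation and then under
-- subtraction. So R is a subgroup of ℤ/N, i.e. the multiples of some h ∣ N, and likewise the column
-- of 0 consists of the multiples of some k ∣ N. The row and the column meet only in 0, so
-- lcm h k = N = m n, whereas counting them gives n h ≤ N and m k ≤ N: hence h = m, k = n and
-- gcd m n = gcd h k = 1.

open import Defs
open import Level using (0ℓ)
open import Algebra.Bundles using (AbelianGroup)
open import Algebra.Structures using (IsAbelianGroup)
import Algebra.Properties.AbelianGroup as AbelianGroupProperties
import Algebra.Properties.Loop as LoopProperties
open import Data.Empty using (⊥-elim)
open import Data.Fin using (Fin; toℕ; fromℕ<; combine; remQuot; punchOut)
open import Data.Fin.Patterns using (0F; 1F; 2F; 3F)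
open import Data.Fin.Properties
  using (toℕ-injective; toℕ-fromℕ<; toℕ<n; ¬Fin0; any?; all?; injective⇒≤; cantor-schröder-bernstein;
         *↔×; combine-injective; remQuot-combine; punchOut-injective)
  renaming (_≟_ to _≟ᶠ_)
open import Data.Nat
  using (ℕ; zero; suc; _+_; _*_; _∸_; _/_; _≤_; _<_; z≤n; s≤s; _≟_; _<?_;
         NonZero; >-nonZero; ≢-nonZero; ≢-nonZero⁻¹)
open import Data.Nat.DivMod
  using (_%_; _mod_; %-distribˡ-+; m%n%n≡m%n; m<n⇒m%n≡m; m%n<n; n%n≡0; m≡m%n+[m/n]*n;
         m∣n⇒o%n%m≡o%m; m/n*n≡m; m<n*o⇒m/o<n)
open import Data.Nat.Divisibility using (_∣_; divides; m%n≡0⇒n∣m; n∣m⇒m%n≡0; ∣⇒≤)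
open import Data.Nat.GCD using (gcd; gcd[m,n]≢0; gcd-zeroˡ; gcd-zeroʳ)
open import Data.Nat.Induction using (<-rec)
open import Data.Nat.LCM using (lcm; m∣lcm[m,n]; n∣lcm[m,n]; lcm-least; gcd*lcm)
open import Data.Nat.Properties
open import Data.Product using (_×_; _,_; ∃; proj₁; proj₂; swap; uncurry)
import Data.Product as Product
open import Data.Product.Algebra using (×-comm)
open import Data.Product.Properties using (≡-dec)
open import Data.Sum using (_⊎_; inj₁; inj₂)
import Data.Sum as Sum
open import Function using (_∘_)
open import Function.Bundles using (_⇔_; mk⇔; _⤖_; mk⤖; Bijection; Equivalence)
open import Function.Consequences.Propositional using (strictlySurjective⇒surjective)
open import Function.Construct.Composition using (_⤖-∘_)
open import Function.Definitions using (Injective; StrictlySurjective)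
open import Function.Properties.Bijection using (⤖⇒↔)
open import Function.Properties.Inverse using (↔⇒⤖; ↔-sym)
open import Relation.Binary.PropositionalEquality
  using (_≡_; _≢_; refl; sym; trans; cong; cong₂; subst; isEquivalence; module ≡-Reasoning)
open import Relation.Nullary
  using (¬_; ¬?; Dec; yes; no; _×-dec_; _⊎-dec_; _→-dec_; contradiction; contraposition)
open import Relation.Nullary.Decidable using (from-yes)
open import Relation.Unary using (Pred; Decidable)

private
  variable
    m n : ℕ

-- The cyclic group ℤ/N and its subgroups

module _ {o : ℕ} .{{_ : NonZero o}} where

  [m%o+n]%o≡[m+n]%o : ∀ m n → (m % o + n) % o ≡ (m + n) % o
  [m%o+n]%o≡[m+n]%o m n = begin
    (m % o + n) % o         ≡⟨ %-distribˡ-+ (m % o) n o ⟩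
    (m % o % o + n % o) % o ≡⟨ cong (λ t → (t + n % o) % o) (m%n%n≡m%n m o) ⟩
    (m % o + n % o) % o     ≡⟨ %-distribˡ-+ m n o ⟨
    (m + n) % o             ∎
    where open ≡-Reasoning

  [m+n%o]%o≡[m+n]%o : ∀ m n → (m + n % o) % o ≡ (m + n) % o
  [m+n%o]%o≡[m+n]%o m n = begin
    (m + n % o) % o ≡⟨ cong (_% o) (+-comm m (n % o)) ⟩
    (n % o + m) % o ≡⟨ [m%o+n]%o≡[m+n]%o n m ⟩
    (n + m) % o     ≡⟨ cong (_% o) (+-comm n m) ⟩
    (m + n) % o     ∎
    where open ≡-Reasoning

module _ {n : ℕ} where

  private
    N = suc n

  toℕ-mod : ∀ a → toℕ (a mod N) ≡ a % N
  toℕ-mod a = toℕ-fromℕ< (m%n<n a N)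

  toℕ-mod-toℕ : ∀ (x : Fin N) → toℕ x mod N ≡ x
  toℕ-mod-toℕ x = toℕ-injective (trans (toℕ-mod (toℕ x)) (m<n⇒m%n≡m (toℕ<n x)))

  infixl 6 _+ₘ_
  _+ₘ_ : Fin N → Fin N → Fin N
  x +ₘ y = (toℕ x + toℕ y) mod N

  mod-distrib-+ : ∀ a b → (a + b) mod N ≡ a mod N +ₘ b mod N
  mod-distrib-+ a b = toℕ-injective (begin
    toℕ ((a + b) mod N)                 ≡⟨ toℕ-mod (a + b) ⟩
    (a + b) % N                         ≡⟨ %-distribˡ-+ a b N ⟩
    (a % N + b % N) % N                 ≡⟨ cong₂ (λ u v → (u + v) % N) (toℕ-mod a) (toℕ-mod b) ⟨
    (toℕ (a mod N) + toℕ (b mod N)) % N ≡⟨ toℕ-mod (toℕ (a mod N) + toℕ (b mod N)) ⟨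
    toℕ (a mod N +ₘ b mod N)            ∎)
    where open ≡-Reasoning

  +ₘ-assoc : ∀ x y z → (x +ₘ y) +ₘ z ≡ x +ₘ (y +ₘ z)
  +ₘ-assoc x y z = toℕ-injective (begin
    toℕ ((x +ₘ y) +ₘ z)               ≡⟨ toℕ-mod (toℕ (x +ₘ y) + toℕ z) ⟩
    (toℕ (x +ₘ y) + toℕ z) % N        ≡⟨ cong (λ t → (t + toℕ z) % N) (toℕ-mod (toℕ x + toℕ y)) ⟩
    ((toℕ x + toℕ y) % N + toℕ z) % N ≡⟨ [m%o+n]%o≡[m+n]%o (toℕ x + toℕ y) (toℕ z) ⟩
    (toℕ x + toℕ y + toℕ z) % N       ≡⟨ cong (_% N) (+-assoc (toℕ x) (toℕ y) (toℕ z)) ⟩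
    (toℕ x + (toℕ y + toℕ z)) % N     ≡⟨ [m+n%o]%o≡[m+n]%o (toℕ x) (toℕ y + toℕ z) ⟨
    (toℕ x + (toℕ y + toℕ z) % N) % N ≡⟨ cong (λ t → (toℕ x + t) % N) (toℕ-mod (toℕ y + toℕ z)) ⟨
    (toℕ x + toℕ (y +ₘ z)) % N        ≡⟨ toℕ-mod (toℕ x + toℕ (y +ₘ z)) ⟨
    toℕ (x +ₘ (y +ₘ z))               ∎)
    where open ≡-Reasoning

  +ₘ-comm : ∀ x y → x +ₘ y ≡ y +ₘ x
  +ₘ-comm x y = cong (_mod N) (+-comm (toℕ x) (toℕ y))

  +ₘ-identityˡ : ∀ x → 0F +ₘ x ≡ x
  +ₘ-identityˡ = toℕ-mod-toℕ

  +ₘ-identityʳ : ∀ x → x +ₘ 0F ≡ x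
  +ₘ-identityʳ x = trans (+ₘ-comm x 0F) (+ₘ-identityˡ x)

  +ₘ-inverseʳ : ∀ x → x +ₘ negMod x ≡ 0F
  +ₘ-inverseʳ x = toℕ-injective (begin
    toℕ (x +ₘ negMod x)           ≡⟨ toℕ-mod (toℕ x + toℕ (negMod x)) ⟩
    (toℕ x + toℕ (negMod x)) % N  ≡⟨ cong (λ t → (toℕ x + t) % N) (toℕ-mod (N ∸ toℕ x)) ⟩
    (toℕ x + (N ∸ toℕ x) % N) % N ≡⟨ [m+n%o]%o≡[m+n]%o (toℕ x) (N ∸ toℕ x) ⟩
    (toℕ x + (N ∸ toℕ x)) % N     ≡⟨ cong (_% N) (m+[n∸m]≡n (<⇒≤ (toℕ<n x))) ⟩
    N % N                         ≡⟨ n%n≡0 N ⟩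
    0                             ∎)
    where open ≡-Reasoning

  +ₘ-isAbelianGroup : IsAbelianGroup _≡_ _+ₘ_ 0F negMod
  +ₘ-isAbelianGroup = record
    { isGroup = record
      { isMonoid = record
        { isSemigroup = record
          { isMagma = record { isEquivalence = isEquivalence ; ∙-cong = cong₂ _+ₘ_ }
          ; assoc   = +ₘ-assoc }
        ; identity = +ₘ-identityˡ , +ₘ-identityʳ }
      ; inverse = (λ x → trans (+ₘ-comm (negMod x) x) (+ₘ-inverseʳ x)) , +ₘ-inverseʳ
      ; ⁻¹-cong = cong negMod }
    ; comm = +ₘ-comm }

ℤ/suc : ℕ → AbelianGroup 0ℓ 0ℓ
ℤ/suc n = record { isAbelianGroup = +ₘ-isAbelianGroup {n} }

subMod≡- : ∀ {k} (j i : Fin (suc k)) → subMod j i ≡ AbelianGroup._-_ (ℤ/suc k) j i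
subMod≡- {k} j i = toℕ-injective (begin
  toℕ (subMod j i)                          ≡⟨ toℕ-mod (toℕ j + (suc k ∸ toℕ i)) ⟩
  (toℕ j + (suc k ∸ toℕ i)) % suc k         ≡⟨ [m+n%o]%o≡[m+n]%o (toℕ j) (suc k ∸ toℕ i) ⟨
  (toℕ j + (suc k ∸ toℕ i) % suc k) % suc k ≡⟨ cong (λ t → (toℕ j + t) % suc k) (toℕ-mod (suc k ∸ toℕ i)) ⟨
  (toℕ j + toℕ (negMod i)) % suc k          ≡⟨ toℕ-mod (toℕ j + toℕ (negMod i)) ⟨
  toℕ (j +ₘ negMod i)                       ∎)
  where open ≡-Reasoning

IsLeast : Pred ℕ 0ℓ → ℕ → Set
IsLeast P k = P k × (∀ {j} → j < k → ¬ P j)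

least-witness : ∀ {P : Pred ℕ 0ℓ} → Decidable P → ∀ {b} → P b → ∃ (IsLeast P)
least-witness {P} P? {b} = <-rec (λ b → P b → ∃ (IsLeast P)) search b
  where
  search : ∀ b → (∀ {j} → j < b → P j → ∃ (IsLeast P)) → P b → ∃ (IsLeast P)
  search b below pb with any? (λ (j : Fin b) → P? (toℕ j))
  ... | yes (j , pj) = below (toℕ<n j) pj
  ... | no  none     = b , pb , λ j<b pj → none (fromℕ< j<b , subst P (sym (toℕ-fromℕ< j<b)) pj)

record MultiplesOfDivisor {n : ℕ} (R : Pred (Fin (suc n)) 0ℓ) : Set where
  field
    divisor      : ℕ
    0<divisor    : 0 < divisor
    divisor∣size : divisor ∣ suc n
    ∈⇔divisor∣   : ∀ x → R x ⇔ divisor ∣ toℕ x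

module DecidableSubgroup {n : ℕ} {R : Pred (Fin (suc n)) 0ℓ} (R? : Decidable R) (R-ε : R 0F)
                         (R-closed : ∀ {x y} → R x → R y → R (AbelianGroup._-_ (ℤ/suc n) x y)) where

  open AbelianGroup (ℤ/suc n) using (_∙_; ε; _⁻¹; _-_; identityˡ)
  open AbelianGroupProperties (ℤ/suc n) using (⁻¹-involutive; x≈z//y)

  private
    N = suc n

  R-∙ : ∀ {x y} → R x → R y → R (x ∙ y)
  R-∙ {x} {y} Rx Ry =
    subst R (cong (x ∙_) (trans (cong _⁻¹ (identityˡ (y ⁻¹))) (⁻¹-involutive y))) (R-closed Rx (R-closed R-ε Ry))

  R-multiple : ∀ {h} → R (h mod N) → ∀ q → R ((q * h) mod N)
  R-multiple Rh zero    = R-ε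
  R-multiple {h} Rh (suc q) = subst R (sym (mod-distrib-+ h (q * h))) (R-∙ Rh (R-multiple Rh q))

  PositiveMember : Pred ℕ 0ℓ
  PositiveMember k = 0 < k × R (k mod N)

  N-mod : N mod N ≡ ε
  N-mod = toℕ-injective (trans (toℕ-mod N) (n%n≡0 N))

  least : ∃ (IsLeast PositiveMember)
  least = least-witness (λ k → 0 <? k ×-dec R? (k mod N)) {N} (s≤s z≤n , subst R (sym N-mod) R-ε)

  generator : ℕ
  generator = proj₁ least

  generator-member : PositiveMember generator
  generator-member = proj₁ (proj₂ least)

  instance
    generator≢0 : NonZero generator
    generator≢0 = >-nonZero (proj₁ generator-member)

  generator∣ : ∀ t → R (t mod N) → generator ∣ t
  generator∣ t Rt with t % generator ≟ 0
  ... | yes t%g≡0 = m%n≡0⇒n∣m t generator t%g≡0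
  ... | no  t%g≢0 = contradiction
    (n≢0⇒n>0 t%g≢0 , subst R (sym remainder) (R-closed Rt (R-multiple (proj₂ generator-member) (t / g))))
    (proj₂ (proj₂ least) (m%n<n t g))
    where
    g = generator
    remainder : (t % g) mod N ≡ t mod N - (t / g * g) mod N
    remainder = x≈z//y _ _ _
      (trans (sym (mod-distrib-+ (t % g) (t / g * g))) (cong (_mod N) (sym (m≡m%n+[m/n]*n t g))))

  multiplesOfDivisor : MultiplesOfDivisor R
  multiplesOfDivisor = record
    { divisor      = generator
    ; 0<divisor    = proj₁ generator-member
    ; divisor∣size = generator∣ N (subst R (sym N-mod) R-ε)
    ; ∈⇔divisor∣   = λ x → mk⇔
        (generator∣ (toℕ x) ∘ subst R (sym (toℕ-mod-toℕ x)))
        (λ { (divides q eq) → subst R (trans (cong (_mod N) (sym eq)) (toℕ-mod-toℕ x))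
                                      (R-multiple (proj₂ generator-member) q) }) }

module _ {h N : ℕ} .{{_ : NonZero h}} (h∣N : h ∣ N) where

  injection-into-multiples⇒*≤ : ∀ {k} (f : Fin k → Fin N) → Injective _≡_ _≡_ f →
                                (∀ i → h ∣ toℕ (f i)) → k * h ≤ N
  injection-into-multiples⇒*≤ {k} f f-injective h∣f = begin
    k * h     ≤⟨ *-monoˡ-≤ h (injective⇒≤ quotient-injective) ⟩
    N / h * h ≡⟨ m/n*n≡m h∣N ⟩
    N         ∎
    where
    open ≤-Reasoning
    quotient : Fin k → Fin (N / h)
    quotient i = fromℕ< (m<n*o⇒m/o<n (subst (toℕ (f i) <_) (sym (m/n*n≡m h∣N)) (toℕ<n (f i))))
    quotient-injective : Injective _≡_ _≡_ quotient
    quotient-injective {i} {j} eq = f-injective (toℕ-injective (begin-equality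
      toℕ (f i)         ≡⟨ m/n*n≡m (h∣f i) ⟨
      toℕ (f i) / h * h ≡⟨ cong (_* h) (trans (sym (toℕ-fromℕ< _)) (trans (cong toℕ eq) (toℕ-fromℕ< _))) ⟩
      toℕ (f j) / h * h ≡⟨ m/n*n≡m (h∣f j) ⟩
      toℕ (f j)         ∎))

lcm≢0 : ∀ h k .{{_ : NonZero h}} .{{_ : NonZero k}} → lcm h k ≢ 0
lcm≢0 h k lcm≡0 = ≢-nonZero⁻¹ (h * k) {{m*n≢0 h k}}
  (trans (sym (gcd*lcm h k)) (trans (cong (gcd h k *_) lcm≡0) (*-zeroʳ (gcd h k))))

no-common-multiple-below⇒lcm≡ : ∀ {h k N} .{{_ : NonZero h}} .{{_ : NonZero k}} .{{_ : NonZero N}} →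
  h ∣ N → k ∣ N → (∀ {x} → x < N → h ∣ x → k ∣ x → x ≡ 0) → lcm h k ≡ N
no-common-multiple-below⇒lcm≡ {h} {k} h∣N k∣N only-zero = ≤-antisym
  (∣⇒≤ (lcm-least h∣N k∣N))
  (≮⇒≥ λ lcm<N → lcm≢0 h k (only-zero lcm<N (m∣lcm[m,n] h k) (n∣lcm[m,n] h k)))

coprime⇒*∣ : ∀ {x} → gcd m n ≡ 1 → m ∣ x → n ∣ x → m * n ∣ x
coprime⇒*∣ {m} {n} gcd≡1 m∣x n∣x = subst (_∣ _) lcm≡mn (lcm-least m∣x n∣x)
  where
  lcm≡mn : lcm m n ≡ m * n
  lcm≡mn = trans (sym (*-identityˡ (lcm m n))) (trans (cong (_* lcm m n) (sym gcd≡1)) (gcd*lcm m n))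

lcm≡*⇒coprime : ∀ {h k} .{{_ : NonZero h}} .{{_ : NonZero k}} →
                lcm h k ≡ m * n → h ≤ m → k ≤ n → gcd m n ≡ 1
lcm≡*⇒coprime {m} {n} {h} {k} lcm≡mn h≤m k≤n = trans (cong₂ gcd (sym h≡m) (sym k≡n)) gcd≡1
  where
  instance
    gcd≢0 : NonZero (gcd h k)
    gcd≢0 = ≢-nonZero (gcd[m,n]≢0 h k (inj₁ (≢-nonZero⁻¹ h)))
  gcd*mn≡hk : gcd h k * (m * n) ≡ h * k
  gcd*mn≡hk = trans (cong (gcd h k *_) (sym lcm≡mn)) (gcd*lcm h k)
  hk≡mn : h * k ≡ m * n
  hk≡mn = ≤-antisym (*-mono-≤ h≤m k≤n) (begin
    m * n             ≤⟨ m≤n*m (m * n) (gcd h k) ⟩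
    gcd h k * (m * n) ≡⟨ gcd*mn≡hk ⟩
    h * k             ∎)
    where open ≤-Reasoning
  instance
    mn≢0 : NonZero (m * n)
    mn≢0 = subst NonZero hk≡mn (m*n≢0 h k)
    m≢0 : NonZero m
    m≢0 = m*n≢0⇒m≢0 m
    n≢0 : NonZero n
    n≢0 = m*n≢0⇒n≢0 m
  gcd≡1 : gcd h k ≡ 1
  gcd≡1 = *-cancelʳ-≡ (gcd h k) 1 (m * n) (trans gcd*mn≡hk (trans hk≡mn (sym (*-identityˡ (m * n)))))
  h≡m : h ≡ m
  h≡m = ≤-antisym h≤m (*-cancelʳ-≤ m h n (subst (_≤ h * n) hk≡mn (*-monoʳ-≤ h k≤n)))
  k≡n : k ≡ n
  k≡n = ≤-antisym k≤n (*-cancelˡ-≤ m (subst (_≤ m * k) hk≡mn (*-monoˡ-≤ k h≤m)))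

infix 4 _~_
_~_ : Fin m × Fin n → Fin m × Fin n → Set
_~_ {m} {n} = Adj (K m □ K n)

_~?_ : (u v : Fin m × Fin n) → Dec (u ~ v)
(a , b) ~? (a′ , b′) = (a ≟ᶠ a′ ×-dec ¬? (b ≟ᶠ b′)) ⊎-dec (b ≟ᶠ b′ ×-dec ¬? (a ≟ᶠ a′))

~-sym : ∀ {u v : Fin m × Fin n} → u ~ v → v ~ u
~-sym (inj₁ (a≡a′ , b≢b′)) = inj₁ (sym a≡a′ , b≢b′ ∘ sym)
~-sym (inj₂ (b≡b′ , a≢a′)) = inj₂ (sym b≡b′ , a≢a′ ∘ sym)

~-swap : ∀ {u v : Fin m × Fin n} → u ~ v → swap u ~ swap v
~-swap = Sum.swap

same-row⇒~ : ∀ {u v : Fin m × Fin n} → proj₁ u ≡ proj₁ v → u ≢ v → u ~ v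
same-row⇒~ a≡a′ u≢v = inj₁ (a≡a′ , λ b≡b′ → u≢v (cong₂ _,_ a≡a′ b≡b′))

same-column⇒~ : ∀ {u v : Fin m × Fin n} → proj₂ u ≡ proj₂ v → u ≢ v → u ~ v
same-column⇒~ b≡b′ u≢v = inj₂ (b≡b′ , λ a≡a′ → u≢v (cong₂ _,_ a≡a′ b≡b′))

row-column-¬~ : ∀ {o p q : Fin m × Fin n} → proj₁ p ≡ proj₁ o → proj₂ q ≡ proj₂ o →
                p ≢ o → q ≢ o → ¬ p ~ q
row-column-¬~ p-row q-column p≢o q≢o (inj₁ (a≡a′ , _)) = q≢o (cong₂ _,_ (trans (sym a≡a′) p-row) q-column)
row-column-¬~ p-row q-column p≢o q≢o (inj₂ (b≡b′ , _)) = p≢o (cong₂ _,_ p-row (trans b≡b′ q-column))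

common-neighbour-of-row-edge : ∀ {x w y : Fin m × Fin n} → proj₁ x ≡ proj₁ w → proj₂ x ≢ proj₂ w →
                               x ~ y → y ~ w → proj₁ x ≡ proj₁ y
common-neighbour-of-row-edge _   _   (inj₁ (x-y , _))   _                = x-y
common-neighbour-of-row-edge x-w _   (inj₂ (_ , x≢y))   (inj₁ (y-w , _)) = contradiction (trans x-w (sym y-w)) x≢y
common-neighbour-of-row-edge _   x≢w (inj₂ (x-y , _))   (inj₂ (y-w , _)) = contradiction (trans x-y y-w) x≢w

common-neighbours-~ : ∀ {x w y y′ : Fin m × Fin n} → x ~ w →
                      x ~ y → y ~ w → x ~ y′ → y′ ~ w → y ≢ y′ → y ~ y′
common-neighbours-~ (inj₁ (x-w , x≢w)) x~y y~w x~y′ y′~w =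
  same-row⇒~ (trans (sym (common-neighbour-of-row-edge x-w x≢w x~y y~w))
                    (common-neighbour-of-row-edge x-w x≢w x~y′ y′~w))
common-neighbours-~ (inj₂ x~w) x~y y~w x~y′ y′~w y≢y′ =
  ~-swap (common-neighbours-~ (inj₁ x~w) (~-swap x~y) (~-swap y~w) (~-swap x~y′) (~-swap y′~w)
                              (y≢y′ ∘ cong swap))

third-element : 3 ≤ m → (u v : Fin m) → ∃ λ w → w ≢ u × w ≢ v
third-element (s≤s (s≤s (s≤s _))) u v with 0F ≟ᶠ u | 0F ≟ᶠ v
... | no 0≢u   | no 0≢v = 0F , 0≢u , 0≢v
... | yes refl | _ with 1F ≟ᶠ v
...   | yes refl = 2F , (λ ()) , (λ ())
...   | no  1≢v  = 1F , (λ ()) , 1≢v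
third-element (s≤s (s≤s (s≤s _))) u v | no 0≢u | yes refl with 1F ≟ᶠ u
...   | yes refl = 2F , (λ ()) , (λ ())
...   | no  1≢u  = 1F , 1≢u , (λ ())

-- Circulant graphs as translation invariant labellings

TranslationInvariant : ∀ {k} (G : Graph) → Fin (suc k) ⤖ V G → Set
TranslationInvariant {k} G lab = ∀ i j → Adj G (to i) (to j) ⇔ Adj G (to ε) (to (j - i))
  where
  open Bijection lab using (to)
  open AbelianGroup (ℤ/suc k) using (ε; _-_)

module _ (G : Graph) {k : ℕ} (lab : Fin (suc k) ⤖ V G) where

  open Bijection lab using (to)
  open AbelianGroup (ℤ/suc k) using (ε; _⁻¹; _-_; identityˡ; identityʳ)
  open AbelianGroupProperties (ℤ/suc k) using (ε⁻¹≈ε)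

  translationInvariant⇒circulant : (∀ {u v} → Adj G u v → Adj G v u) →
                                   TranslationInvariant G lab → IsCirculant G
  translationInvariant⇒circulant adj-sym invariant = suc k , lab , S , S-neg , S-adj
    where
    S : Fin (suc k) → Set
    S s = Adj G (to ε) (to s)
    S-neg : ∀ s → S s → S (negMod s)
    S-neg s Ss = subst S (identityˡ (s ⁻¹)) (Equivalence.to (invariant s ε) (adj-sym Ss))
    S-adj : ∀ i j → (Adj G (to i) (to j) → S (subMod j i)) × (S (subMod j i) → Adj G (to i) (to j))
    S-adj i j = subst S (sym (subMod≡- j i)) ∘ Equivalence.to (invariant i j)
              , Equivalence.from (invariant i j) ∘ subst S (subMod≡- j i)

  circulant⇒translationInvariant : (S : Fin (suc k) → Set) →
    (∀ i j → (Adj G (to i) (to j) → S (subMod j i)) × (S (subMod j i) → Adj G (to i) (to j))) →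
    TranslationInvariant G lab
  circulant⇒translationInvariant S S-adj i j = mk⇔
    (proj₂ (S-adj ε (j - i)) ∘ subst S (sym (subMod-ε (j - i))) ∘ subst S (subMod≡- j i) ∘ proj₁ (S-adj i j))
    (proj₂ (S-adj i j) ∘ subst S (sym (subMod≡- j i)) ∘ subst S (subMod-ε (j - i)) ∘ proj₁ (S-adj ε (j - i)))
    where
    subMod-ε : ∀ x → subMod x ε ≡ x
    subMod-ε x = trans (subMod≡- x ε) (trans (cong (x +ₘ_) ε⁻¹≈ε) (identityʳ x))

swap-labelling : ∀ {N} → Fin N ⤖ (Fin m × Fin n) → Fin N ⤖ (Fin n × Fin m)
swap-labelling lab = ↔⇒⤖ (×-comm _ _) ⤖-∘ lab

swap-translationInvariant : ∀ {k} (lab : Fin (suc k) ⤖ (Fin m × Fin n)) →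
                            TranslationInvariant (K m □ K n) lab →
                            TranslationInvariant (K n □ K m) (swap-labelling lab)
swap-translationInvariant _ invariant i j = mk⇔
  (~-swap ∘ Equivalence.to (invariant i j) ∘ ~-swap)
  (~-swap ∘ Equivalence.from (invariant i j) ∘ ~-swap)

product-labelling-size : ∀ {N} → Fin N ⤖ (Fin m × Fin n) → N ≡ m * n
product-labelling-size lab =
  cantor-schröder-bernstein (Bijection.injective bij) (Bijection.injective (↔⇒⤖ (↔-sym (⤖⇒↔ bij))))
  where bij = ↔⇒⤖ (↔-sym *↔×) ⤖-∘ lab

-- Rows of translation invariant labellings are subgroups

module TranslationInvariantLabelling {k : ℕ} (lab : Fin (suc k) ⤖ (Fin m × Fin n))
                                     (invariant : TranslationInvariant (K m □ K n) lab) where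

  open Bijection lab public using (to) renaming (injective to to-injective)
  open AbelianGroup (ℤ/suc k) public using (ε; _∙_; _⁻¹; _-_)
  open AbelianGroup (ℤ/suc k) using (comm; identityˡ)
  open AbelianGroupProperties (ℤ/suc k) using (⁻¹-involutive; //-rightDividesʳ)

  from : Fin m × Fin n → Fin (suc k)
  from v = proj₁ (Bijection.strictlySurjective lab v)

  to-from : ∀ v → to (from v) ≡ v
  to-from v = proj₂ (Bijection.strictlySurjective lab v)

  infix 4 _~ₗ_
  _~ₗ_ : Fin (suc k) → Fin (suc k) → Set
  i ~ₗ j = to i ~ to j

  OnRow OnColumn : Pred (Fin (suc k)) 0ℓ
  OnRow    x = proj₁ (to x) ≡ proj₁ (to ε)
  OnColumn x = proj₂ (to x) ≡ proj₂ (to ε)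

  on-row-and-column⇒≡ε : ∀ {x} → OnRow x → OnColumn x → x ≡ ε
  on-row-and-column⇒≡ε x-row x-column = to-injective (cong₂ _,_ x-row x-column)

  shift : ∀ {i j} → i ~ₗ j → ε ~ₗ j - i
  shift {i} {j} = Equivalence.to (invariant i j)

  unshift : ∀ {i j} → ε ~ₗ j - i → i ~ₗ j
  unshift {i} {j} = Equivalence.from (invariant i j)

  ε~ₗ⇒ε~ₗ⁻¹ : ∀ {p} → ε ~ₗ p → ε ~ₗ p ⁻¹
  ε~ₗ⇒ε~ₗ⁻¹ {p} ε~p = subst (ε ~ₗ_) (identityˡ (p ⁻¹)) (shift (~-sym ε~p))

  on-row⇒ε~ₗ : ∀ {x} → OnRow x → x ≢ ε → ε ~ₗ x
  on-row⇒ε~ₗ x-row x≢ε = same-row⇒~ (sym x-row) (x≢ε ∘ sym ∘ to-injective)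

  on-column⇒ε~ₗ : ∀ {x} → OnColumn x → x ≢ ε → ε ~ₗ x
  on-column⇒ε~ₗ x-column x≢ε = same-column⇒~ (sym x-column) (x≢ε ∘ sym ∘ to-injective)

  ε~ₗ⇒on-row⊎on-column : ∀ {x} → ε ~ₗ x → OnRow x ⊎ OnColumn x
  ε~ₗ⇒on-row⊎on-column (inj₁ (a≡a′ , _)) = inj₁ (sym a≡a′)
  ε~ₗ⇒on-row⊎on-column (inj₂ (b≡b′ , _)) = inj₂ (sym b≡b′)

  inverse-off-row⇒on-column : ∀ {p} → OnRow p → p ≢ ε → ¬ OnRow (p ⁻¹) → OnColumn (p ⁻¹)
  inverse-off-row⇒on-column p-row p≢ε p⁻¹-off-row =
    Sum.fromInj₂ (λ p⁻¹-row → contradiction p⁻¹-row p⁻¹-off-row)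
                 (ε~ₗ⇒on-row⊎on-column (ε~ₗ⇒ε~ₗ⁻¹ (on-row⇒ε~ₗ p-row p≢ε)))

  column-has-third : 3 ≤ m → ∀ x y → ∃ λ q → OnColumn q × q ≢ x × q ≢ y
  column-has-third 3≤m x y with a , a≢x , a≢y ← third-element 3≤m (proj₁ (to x)) (proj₁ (to y)) =
    q , cong proj₂ (to-from _) , row-differs a≢x , row-differs a≢y
    where
    q = from (a , proj₂ (to ε))
    row-differs : ∀ {z} → a ≢ proj₁ (to z) → q ≢ z
    row-differs a≢z q≡z = a≢z (trans (sym (cong proj₁ (to-from _))) (cong (proj₁ ∘ to) q≡z))

  -- If q ≢ p ⁻¹, then p and q are distinct common neighbours of the edge from ε to q ∙ p, hence
  -- adjacent, although p lies on the row and q on the column of ε.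
  inverse-off-row⇒column≡inverse : ∀ {p} → OnRow p → p ≢ ε → ¬ OnRow (p ⁻¹) →
                                   ∀ {q} → OnColumn q → q ≢ ε → q ≡ p ⁻¹
  inverse-off-row⇒column≡inverse {p} p-row p≢ε p⁻¹-off-row {q} q-column q≢ε with q ≟ᶠ p ⁻¹
  ... | yes q≡p⁻¹ = q≡p⁻¹
  ... | no  q≢p⁻¹ =
    contradiction p~q (row-column-¬~ p-row q-column (p≢ε ∘ to-injective) (q≢ε ∘ to-injective))
    where
    ε~p = on-row⇒ε~ₗ p-row p≢ε
    ε~q = on-column⇒ε~ₗ q-column q≢ε
    p⁻¹~q : p ⁻¹ ~ₗ q
    p⁻¹~q = same-column⇒~ (trans (inverse-off-row⇒on-column p-row p≢ε p⁻¹-off-row) (sym q-column))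
                          (q≢p⁻¹ ∘ sym ∘ to-injective)
    ε~qp : ε ~ₗ q ∙ p
    ε~qp = subst (ε ~ₗ_) (cong (q ∙_) (⁻¹-involutive p)) (shift p⁻¹~q)
    p~qp : p ~ₗ q ∙ p
    p~qp = unshift (subst (ε ~ₗ_) (sym (//-rightDividesʳ p q)) ε~q)
    q~qp : q ~ₗ q ∙ p
    q~qp = unshift (subst (ε ~ₗ_) (sym (trans (cong (_- q) (comm q p)) (//-rightDividesʳ q p))) ε~p)
    p≢q : p ≢ q
    p≢q p≡q = p≢ε (on-row-and-column⇒≡ε p-row (subst OnColumn (sym p≡q) q-column))
    p~q : p ~ₗ q
    p~q = common-neighbours-~ ε~qp ε~p p~qp ε~q q~qp (p≢q ∘ to-injective)

module RowSubgroup {k : ℕ} (lab : Fin (suc k) ⤖ (Fin m × Fin n))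
                   (invariant : TranslationInvariant (K m □ K n) lab) (3≤m⊎3≤n : 3 ≤ m ⊎ 3 ≤ n) where

  open TranslationInvariantLabelling lab invariant public
  private
    module Transposed =
      TranslationInvariantLabelling (swap-labelling lab) (swap-translationInvariant lab invariant)
  open AbelianGroup (ℤ/suc k) using (identityˡ)
  open AbelianGroupProperties (ℤ/suc k)
    using (⁻¹-involutive; ⁻¹-injective; ε⁻¹≈ε; //-rightDividesˡ; x∙y⁻¹≈ε⇒x≈y; loop)
  open LoopProperties loop using (x//x≈ε; x//ε≈x)

  ⁻¹≢ε : ∀ {p} → p ≢ ε → p ⁻¹ ≢ ε
  ⁻¹≢ε p≢ε p⁻¹≡ε = p≢ε (⁻¹-injective (trans p⁻¹≡ε (sym ε⁻¹≈ε)))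

  -- Needs 3 ≤ m ⊎ 3 ≤ n: labelling K₂ □ K₂ around its 4-cycle, the row of 0 is {0, 1} but −1 = 3.
  row-closed-under-⁻¹ : ∀ {p} → OnRow p → OnRow (p ⁻¹)
  row-closed-under-⁻¹ {p} p-row with p ≟ᶠ ε | proj₁ (to (p ⁻¹)) ≟ᶠ proj₁ (to ε)
  ... | yes refl | _               = subst OnRow (sym ε⁻¹≈ε) refl
  ... | no  _    | yes p⁻¹-row     = p⁻¹-row
  ... | no  p≢ε  | no  p⁻¹-off-row = Sum.[ third-on-column , third-on-row ] 3≤m⊎3≤n
    where
    third-on-column : 3 ≤ m → OnRow (p ⁻¹)
    third-on-column 3≤m with q , q-column , q≢ε , q≢p⁻¹ ← column-has-third 3≤m ε (p ⁻¹) =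
      contradiction (inverse-off-row⇒column≡inverse p-row p≢ε p⁻¹-off-row q-column q≢ε) q≢p⁻¹
    third-on-row : 3 ≤ n → OnRow (p ⁻¹)
    third-on-row 3≤n with q , q-row , q≢ε , q≢p ← Transposed.column-has-third 3≤n ε p =
      contradiction (trans q≡p⁻¹⁻¹ (⁻¹-involutive p)) q≢p
      where
      p⁻¹-column = inverse-off-row⇒on-column p-row p≢ε p⁻¹-off-row
      p-off-column : ¬ OnColumn (p ⁻¹ ⁻¹)
      p-off-column p-column = p≢ε (on-row-and-column⇒≡ε p-row (subst OnColumn (⁻¹-involutive p) p-column))
      q≡p⁻¹⁻¹ = Transposed.inverse-off-row⇒column≡inverse p⁻¹-column (⁻¹≢ε p≢ε) p-off-column q-row q≢ε

  row-closed-under-subtraction : ∀ {x y} → OnRow x → OnRow y → OnRow (x - y)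
  row-closed-under-subtraction {x} {y} x-row y-row with x ≟ᶠ y | y ≟ᶠ ε | x ≟ᶠ ε
  ... | yes refl | _        | _        = subst OnRow (sym (x//x≈ε x)) refl
  ... | no  _    | yes refl | _        = subst OnRow (sym (x//ε≈x x)) x-row
  ... | no  _    | no  _    | yes refl = subst OnRow (sym (identityˡ (y ⁻¹))) (row-closed-under-⁻¹ y-row)
  ... | no  x≢y  | no  y≢ε  | no  x≢ε  =
    Sum.fromInj₁ (λ d-column → contradiction y⁻¹~d (¬y⁻¹~d d-column)) (ε~ₗ⇒on-row⊎on-column ε~d)
    where
    d = x - y
    ε~d : ε ~ₗ d
    ε~d = shift (same-row⇒~ (trans y-row (sym x-row)) (x≢y ∘ sym ∘ to-injective))
    y⁻¹~d : y ⁻¹ ~ₗ d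
    y⁻¹~d = unshift (subst (ε ~ₗ_) (sym (trans (cong (d ∙_) (⁻¹-involutive y)) (//-rightDividesˡ y x)))
                           (on-row⇒ε~ₗ x-row x≢ε))
    ¬y⁻¹~d : OnColumn d → ¬ y ⁻¹ ~ₗ d
    ¬y⁻¹~d d-column = row-column-¬~ (row-closed-under-⁻¹ y-row) d-column
                        (⁻¹≢ε y≢ε ∘ to-injective) (x≢y ∘ x∙y⁻¹≈ε⇒x≈y x y ∘ to-injective)

  open MultiplesOfDivisor
    (DecidableSubgroup.multiplesOfDivisor (λ x → proj₁ (to x) ≟ᶠ proj₁ (to ε)) refl row-closed-under-subtraction) public

  n*divisor≤size : n * divisor ≤ suc k
  n*divisor≤size =
    injection-into-multiples⇒*≤ {{>-nonZero 0<divisor}} divisor∣size row-vertex row-vertex-injective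
      (λ b → Equivalence.to (∈⇔divisor∣ (row-vertex b)) (cong proj₁ (to-from _)))
    where
    row-vertex : Fin n → Fin (suc k)
    row-vertex b = from (proj₁ (to ε) , b)
    row-vertex-injective : Injective _≡_ _≡_ row-vertex
    row-vertex-injective eq = cong proj₂ (trans (sym (to-from _)) (trans (cong to eq) (to-from _)))

Fin⇒NonZero : Fin n → NonZero n
Fin⇒NonZero {suc _} _ = _

translationInvariant⇒coprime : ∀ {k} (lab : Fin (suc k) ⤖ (Fin m × Fin n)) →
                               TranslationInvariant (K m □ K n) lab → 3 ≤ m ⊎ 3 ≤ n → gcd m n ≡ 1
translationInvariant⇒coprime {m} {n} {k} lab invariant 3≤m⊎3≤n =
  lcm≡*⇒coprime (trans lcm≡size size) rows-divisor≤m columns-divisor≤n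
  where
  module Rows    = RowSubgroup lab invariant 3≤m⊎3≤n
  module Columns = RowSubgroup (swap-labelling lab) (swap-translationInvariant lab invariant) (Sum.swap 3≤m⊎3≤n)
  instance
    m≢0 = Fin⇒NonZero (proj₁ (Rows.to Rows.ε))
    n≢0 = Fin⇒NonZero (proj₂ (Rows.to Rows.ε))
    rows-divisor≢0 = >-nonZero Rows.0<divisor
    columns-divisor≢0 = >-nonZero Columns.0<divisor
  size : suc k ≡ m * n
  size = product-labelling-size lab
  rows-divisor≤m : Rows.divisor ≤ m
  rows-divisor≤m = *-cancelˡ-≤ n (subst (n * Rows.divisor ≤_) (trans size (*-comm m n)) Rows.n*divisor≤size)
  columns-divisor≤n : Columns.divisor ≤ n
  columns-divisor≤n = *-cancelˡ-≤ m (subst (m * Columns.divisor ≤_) size Columns.n*divisor≤size)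
  row∩column≡0 : ∀ {x} → x < suc k → Rows.divisor ∣ x → Columns.divisor ∣ x → x ≡ 0
  row∩column≡0 {x} x<size rows∣x columns∣x =
    trans (sym (toℕ-fromℕ< x<size)) (cong toℕ (Rows.on-row-and-column⇒≡ε x-row x-column))
    where
    x≡ = sym (toℕ-fromℕ< x<size)
    x-row = Equivalence.from (Rows.∈⇔divisor∣ (fromℕ< x<size)) (subst (Rows.divisor ∣_) x≡ rows∣x)
    x-column = Equivalence.from (Columns.∈⇔divisor∣ (fromℕ< x<size)) (subst (Columns.divisor ∣_) x≡ columns∣x)
  lcm≡size : lcm Rows.divisor Columns.divisor ≡ suc k
  lcm≡size = no-common-multiple-below⇒lcm≡ Rows.divisor∣size Columns.divisor∣size row∩column≡0

-- Translation invariant labellings of K_m □ K_n for coprime m, n and for m = n = 2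

injective⇒strictlySurjective : ∀ {a b} (f : Fin a → Fin b) → b ≤ a → Injective _≡_ _≡_ f →
                               StrictlySurjective _≡_ f
injective⇒strictlySurjective {a} {suc b} f b<a f-injective y with any? (λ x → f x ≟ᶠ y)
... | yes hit  = hit
... | no  miss = contradiction (injective⇒≤ punched-injective) (<⇒≱ b<a)
  where
  y≢f : ∀ x → y ≢ f x
  y≢f x y≡fx = miss (x , sym y≡fx)
  punched : Fin a → Fin b
  punched x = punchOut (y≢f x)
  punched-injective : Injective _≡_ _≡_ punched
  punched-injective = f-injective ∘ punchOut-injective (y≢f _) (y≢f _)

injection⇒labelling : ∀ {N} (f : Fin N → Fin m × Fin n) → m * n ≤ N → Injective _≡_ _≡_ f →
                      Fin N ⤖ (Fin m × Fin n)
injection⇒labelling {n = n} f mn≤N f-injective =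
  mk⤖ (f-injective , strictlySurjective⇒surjective f-surjective)
  where
  combined-injective : Injective _≡_ _≡_ (uncurry combine ∘ f)
  combined-injective eq = f-injective (uncurry (cong₂ _,_) (combine-injective _ _ _ _ eq))
  f-surjective : StrictlySurjective _≡_ f
  f-surjective v@(a , b)
    with x , combined≡ ← injective⇒strictlySurjective _ mn≤N combined-injective (combine a b) =
    x , (begin
      f x                               ≡⟨ remQuot-combine (proj₁ (f x)) (proj₂ (f x)) ⟨
      remQuot n (uncurry combine (f x)) ≡⟨ cong (remQuot n) combined≡ ⟩
      remQuot n (combine a b)           ≡⟨ remQuot-combine a b ⟩
      v                                 ∎)
    where open ≡-Reasoning

coordinatewise⇒translationInvariant : ∀ {k} (lab : Fin (suc k) ⤖ (Fin m × Fin n)) →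
  let open Bijection lab using (to); open AbelianGroup (ℤ/suc k) using (ε; _-_) in
  (∀ i j → (proj₁ (to i) ≡ proj₁ (to j)) ⇔ (proj₁ (to ε) ≡ proj₁ (to (j - i)))) →
  (∀ i j → (proj₂ (to i) ≡ proj₂ (to j)) ⇔ (proj₂ (to ε) ≡ proj₂ (to (j - i)))) →
  TranslationInvariant (K m □ K n) lab
coordinatewise⇒translationInvariant lab rows columns i j = mk⇔
  (Sum.map (Product.map (to (rows i j)) (contraposition (from (columns i j))))
           (Product.map (to (columns i j)) (contraposition (from (rows i j)))))
  (Sum.map (Product.map (from (rows i j)) (contraposition (to (columns i j))))
           (Product.map (from (columns i j)) (contraposition (to (rows i j)))))
  where open Equivalence

module Reduction {k d : ℕ} (d∣size : suc d ∣ suc k) where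

  open AbelianGroup (ℤ/suc k) using (ε; _-_)
  open AbelianGroupProperties (ℤ/suc k) using (//-rightDividesˡ)
  open LoopProperties (AbelianGroupProperties.loop (ℤ/suc d)) using (identityˡ-unique)

  reduce : Fin (suc k) → Fin (suc d)
  reduce x = toℕ x mod suc d

  reduce-+ₘ : ∀ x y → reduce (x +ₘ y) ≡ reduce x +ₘ reduce y
  reduce-+ₘ x y = toℕ-injective (begin
    toℕ (reduce (x +ₘ y))                     ≡⟨ toℕ-mod (toℕ (x +ₘ y)) ⟩
    toℕ (x +ₘ y) % suc d                      ≡⟨ cong (_% suc d) (toℕ-mod (toℕ x + toℕ y)) ⟩
    (toℕ x + toℕ y) % suc k % suc d           ≡⟨ m∣n⇒o%n%m≡o%m (suc d) (suc k) (toℕ x + toℕ y) d∣size ⟩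
    (toℕ x + toℕ y) % suc d                   ≡⟨ %-distribˡ-+ (toℕ x) (toℕ y) (suc d) ⟩
    (toℕ x % suc d + toℕ y % suc d) % suc d
      ≡⟨ cong₂ (λ u v → (u + v) % suc d) (toℕ-mod (toℕ x)) (toℕ-mod (toℕ y)) ⟨
    (toℕ (reduce x) + toℕ (reduce y)) % suc d ≡⟨ toℕ-mod (toℕ (reduce x) + toℕ (reduce y)) ⟨
    toℕ (reduce x +ₘ reduce y)                ∎)
    where open ≡-Reasoning

  reduce-≡⇔ : ∀ i j → (reduce i ≡ reduce j) ⇔ (reduce ε ≡ reduce (j - i))
  reduce-≡⇔ i j = mk⇔
    (λ i≡j → sym (identityˡ-unique (reduce (j - i)) (reduce i) (trans recompose (sym i≡j))))
    (λ ε≡j-i → trans (sym (+ₘ-identityˡ (reduce i))) (trans (cong (_+ₘ reduce i) ε≡j-i) recompose))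
    where
    recompose : reduce (j - i) +ₘ reduce i ≡ reduce j
    recompose = trans (sym (reduce-+ₘ (j - i) i)) (cong reduce (//-rightDividesˡ i j))

  reduce≡ε⇒∣ : ∀ x → reduce ε ≡ reduce x → suc d ∣ toℕ x
  reduce≡ε⇒∣ x ε≡x = m%n≡0⇒n∣m (toℕ x) (suc d) (trans (sym (toℕ-mod (toℕ x))) (cong toℕ (sym ε≡x)))

module ChineseRemainder {m n : ℕ} (coprime : gcd (suc m) (suc n) ≡ 1) where

  private
    N = suc m * suc n
    module Rows    = Reduction {d = m} (divides (suc n) (*-comm (suc m) (suc n)))
    module Columns = Reduction {d = n} (divides (suc m) refl)
  open AbelianGroup (ℤ/suc (n + m * suc n)) using (_-_)
  open AbelianGroupProperties (ℤ/suc (n + m * suc n)) using (x∙y⁻¹≈ε⇒x≈y)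

  residues : Fin N → Fin (suc m) × Fin (suc n)
  residues x = Rows.reduce x , Columns.reduce x

  residues-injective : Injective _≡_ _≡_ residues
  residues-injective {i} {j} eq = sym (x∙y⁻¹≈ε⇒x≈y j i (toℕ-injective toℕ[j-i]≡0))
    where
    N∣j-i : N ∣ toℕ (j - i)
    N∣j-i = coprime⇒*∣ coprime
      (Rows.reduce≡ε⇒∣ (j - i) (Equivalence.to (Rows.reduce-≡⇔ i j) (cong proj₁ eq)))
      (Columns.reduce≡ε⇒∣ (j - i) (Equivalence.to (Columns.reduce-≡⇔ i j) (cong proj₂ eq)))
    toℕ[j-i]≡0 : toℕ (j - i) ≡ 0
    toℕ[j-i]≡0 = trans (sym (m<n⇒m%n≡m (toℕ<n (j - i)))) (n∣m⇒m%n≡0 (toℕ (j - i)) N N∣j-i)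

  labelling : Fin N ⤖ (Fin (suc m) × Fin (suc n))
  labelling = injection⇒labelling residues ≤-refl residues-injective

  translationInvariant : TranslationInvariant (K (suc m) □ K (suc n)) labelling
  translationInvariant = coordinatewise⇒translationInvariant labelling Rows.reduce-≡⇔ Columns.reduce-≡⇔

module Square where

  open AbelianGroup (ℤ/suc 3) using (ε; _-_)

  corners : Fin 4 → Fin 2 × Fin 2
  corners 0F = 0F , 0F
  corners 1F = 0F , 1F
  corners 2F = 1F , 1F
  corners 3F = 1F , 0F

  corners-injective : Injective _≡_ _≡_ corners
  corners-injective {i} {j} =
    from-yes (all? λ i → all? λ j → ≡-dec _≟ᶠ_ _≟ᶠ_ (corners i) (corners j) →-dec i ≟ᶠ j) i j

  labelling : Fin 4 ⤖ (Fin 2 × Fin 2)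
  labelling = injection⇒labelling corners ≤-refl corners-injective

  translationInvariant : TranslationInvariant (K 2 □ K 2) labelling
  translationInvariant i j = mk⇔
    (from-yes (all? λ i → all? λ j → corners i ~? corners j →-dec corners ε ~? corners (j - i)) i j)
    (from-yes (all? λ i → all? λ j → corners ε ~? corners (j - i) →-dec corners i ~? corners j) i j)

gcd≡1⊎2,2⊎≥3 : ∀ m n → 1 ≤ m → 1 ≤ n → gcd m n ≡ 1 ⊎ (m ≡ 2 × n ≡ 2) ⊎ (3 ≤ m ⊎ 3 ≤ n)
gcd≡1⊎2,2⊎≥3 1                   n                   _ _ = inj₁ (gcd-zeroˡ n)
gcd≡1⊎2,2⊎≥3 m@(suc (suc _))     1                   _ _ = inj₁ (gcd-zeroʳ m)
gcd≡1⊎2,2⊎≥3 2                   2                   _ _ = inj₂ (inj₁ (refl , refl))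
gcd≡1⊎2,2⊎≥3 (suc (suc (suc _))) (suc (suc _))       _ _ = inj₂ (inj₂ (inj₁ (s≤s (s≤s (s≤s z≤n)))))
gcd≡1⊎2,2⊎≥3 2                   (suc (suc (suc _))) _ _ = inj₂ (inj₂ (inj₂ (s≤s (s≤s (s≤s z≤n)))))

corollary5 : (m n : ℕ) → 1 ≤ m → 1 ≤ n →
    (IsCirculant (K m □ K n) ⇔ (gcd m n ≡ 1 ⊎ (m ≡ 2 × n ≡ 2)))
corollary5 m@(suc _) n@(suc _) 1≤m 1≤n = mk⇔ circulant⇒ ⇒circulant
  where
  circulant⇒ : IsCirculant (K m □ K n) → gcd m n ≡ 1 ⊎ (m ≡ 2 × n ≡ 2)
  circulant⇒ (zero  , lab , _) = ⊥-elim (¬Fin0 (proj₁ (Bijection.strictlySurjective lab (0F , 0F))))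
  circulant⇒ (suc k , lab , S , _ , S-adj) with gcd≡1⊎2,2⊎≥3 m n 1≤m 1≤n
  ... | inj₁ coprime        = inj₁ coprime
  ... | inj₂ (inj₁ 2,2)     = inj₂ 2,2
  ... | inj₂ (inj₂ 3≤m⊎3≤n) = inj₁ (translationInvariant⇒coprime lab
                                  (circulant⇒translationInvariant (K m □ K n) lab S S-adj) 3≤m⊎3≤n)
  ⇒circulant : gcd m n ≡ 1 ⊎ (m ≡ 2 × n ≡ 2) → IsCirculant (K m □ K n)
  ⇒circulant (inj₁ coprime) = translationInvariant⇒circulant (K m □ K n) (ChineseRemainder.labelling coprime)
                                ~-sym (ChineseRemainder.translationInvariant coprime)
  ⇒circulant (inj₂ (refl , refl)) = translationInvariant⇒circulant (K 2 □ K 2) Square.labelling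
                                      ~-sym Square.translationInvariant
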